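{- A permutation $\pi$ is separable if and only if $w(\pi)\le 1$.
   Context: A permutation is a pair $\pi=(S,P)$, $S$ a finite set of positive integers, $P:S\to\mathbb{N}^2$ injective with $P(S)$ in general position. For $\alpha\in\{1,2\}$, $p<^{\pi}_{\alpha}p'$ means the $\alpha$-th coordinate of $P(p)$ is smaller than that of $P(p')$. $\pi$ is increasing (resp. decreasing) if for all $p,p'\in S$, $p<^\pi_1p'$ iff $p<^\pi_2p'$ (resp. iff $p'<^\pi_2p$); monotone if increasing or decreasing. Substitution: for $\pi=(S,P)$, $\pi'=(S',P')$, $S\cap S'=\emptyset$, $x\in S$, $\pi[x\leftarrow\pi']$ is a permutation on $S\setminus\{x\}\cup S'$ whose orders $<_\alpha$ agree with $\pi$ on $S\setminus\{x\}$, with $\pi'$ on $S'$, and for $p\in S\setminus\{x\}$, $p'\in S'$ satisfy $p<_\alpha p'$ iff $p<^\pi_\alpha x$. The separable permutations form the smallest class of permutations containing the monotone permutations and closed under substitution (equivalently, the permutations avoiding the patterns $2413$ and $3142$). Intervals are discrete; a rectangle is $R=I_1(R)\times I_2(R)$. A rectangle family is $\mathcal{R}=(S,R)$ assigning a rectangle to each index; a permutation is the family $R(i)=\{P(i)\}$. $\mathcal{R}[i,j\to k]$ replaces $R(i),R(j)$ by their bounding box indexed by a new $k$. A decomposition of $\pi$ is $(\mathcal{R}_0,\dots,\mathcal{R}_s)$ with $\mathcal{R}_0=\pi$, $\max S<k_1<\dots<k_s$, $\mathcal{R}_p=\mathcal{R}_{p-1}[i,j\to k_p]$, $|\mathcal{R}_s|=1$.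 $R,R'$ $\alpha$-view each other if $I_\alpha(R)\cap I_\alpha(R')\ne\emptyset$; $\mathrm{view}(\mathcal{R},i)=\max_\alpha|\{j\ne i: R(i),R(j)\ \alpha\text{ -view each other}\}|$; $\mathcal{R}$ is $d$-wide if $\mathrm{view}(\mathcal{R},i)<d$ for all $i$; a decomposition is $d$-wide if all its families are; $w(\pi)$ is the minimum $d$ such that $\pi$ has a $d$-wide decomposition. -}

module Defs where

open import Data.Nat using (ℕ; zero; suc; _<_; _≤_; _⊔_; _⊓_; _≟_)
open import Data.Nat.Properties using (_<?_; _≤?_)
open import Data.Product using (Σ; _×_; _,_; proj₁; proj₂)
open import Data.Sum using (_⊎_)
open import Data.List using (List; []; _∷_; map; filter; length; foldr)
open import Data.List.Relation.Unary.All using (All)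
open import Data.List.Relation.Unary.Unique.Propositional using (Unique)
open import Data.List.Membership.Propositional using (_∈_; _∉_)
open import Relation.Binary.PropositionalEquality using (_≡_; _≢_)
open import Relation.Nullary using (¬_; ¬?)
open import Relation.Nullary.Decidable using (_×-dec_)
open import Function using (_∘_; _⇔_)

data Dim : Set where
  d₁ d₂ : Dim

Point : Set
Point = ℕ × ℕ

coord : Dim → Point → ℕ
coord d₁ p = proj₁ p
coord d₂ p = proj₂ p

-- Permutations π = (S , P): stored as the graph of P, a list of
-- entries (p , P(p)).

record Perm : Set where
  field
    elems    : List (ℕ × Point)
    positive : All (λ e → 0 < proj₁ e) elems
    uniqueS  : Unique (map proj₁ elems)
    genPos₁  : Unique (map (coord d₁ ∘ proj₂) elems)
    genPos₂  : Unique (map (coord d₂ ∘ proj₂) elems)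
open Perm public

labels : Perm → List ℕ
labels π = map proj₁ (elems π)

Lt : Perm → Dim → ℕ → ℕ → Set
Lt π α p q = Σ Point λ P → Σ Point λ Q →
  ((p , P) ∈ elems π) × ((q , Q) ∈ elems π) × (coord α P < coord α Q)

Increasing : Perm → Set
Increasing π = ∀ p q → p ∈ labels π → q ∈ labels π →
  Lt π d₁ p q ⇔ Lt π d₂ p q

Decreasing : Perm → Set
Decreasing π = ∀ p q → p ∈ labels π → q ∈ labels π →
  Lt π d₁ p q ⇔ Lt π d₂ q p

Monotone : Perm → Set
Monotone π = Increasing π ⊎ Decreasing π

-- IsSubst π x π' σ : σ is (a) permutation π[x ← π'], i.e. a permutation
-- on S∖{x} ∪ S' whose orders are as prescribed.  (S ∩ S' = ∅, x ∈ S.)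
record IsSubst (π : Perm) (x : ℕ) (π' : Perm) (σ : Perm) : Set where
  field
    disjoint : ∀ l → l ∈ labels π → l ∉ labels π'
    x∈S      : x ∈ labels π
    support  : ∀ l → l ∈ labels σ ⇔ ((l ∈ labels π × l ≢ x) ⊎ l ∈ labels π')
    agreeπ   : ∀ α p q → p ∈ labels π → p ≢ x → q ∈ labels π → q ≢ x →
               Lt σ α p q ⇔ Lt π α p q
    agreeπ'  : ∀ α p q → p ∈ labels π' → q ∈ labels π' →
               Lt σ α p q ⇔ Lt π' α p q
    across   : ∀ α p q → p ∈ labels π → p ≢ x → q ∈ labels π' →
               Lt σ α p q ⇔ Lt π α p x

data Separable : Perm → Set where
  mono  : ∀ {π} → Monotone π → Separable π
  subst : ∀ {π π' σ} x → Separable π → Separable π' → IsSubst π x π' σ →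
          Separable σ

record Interval : Set where
  constructor [_,_]
  field
    lo hi : ℕ
open Interval public

record Rect : Set where
  constructor _⊠_
  field
    I₁ I₂ : Interval
open Rect public

Iα : Dim → Rect → Interval
Iα d₁ R = I₁ R
Iα d₂ R = I₂ R

-- I ∩ J = [max lo, min hi]; nonempty iff max lo ≤ min hi
IntersectsNonempty : Interval → Interval → Set
IntersectsNonempty I J = (lo I ⊔ lo J) ≤ (hi I ⊓ hi J)

bbox : Rect → Rect → Rect
bbox R R' = [ lo (I₁ R) ⊓ lo (I₁ R') , hi (I₁ R) ⊔ hi (I₁ R') ]
          ⊠ [ lo (I₂ R) ⊓ lo (I₂ R') , hi (I₂ R) ⊔ hi (I₂ R') ]

-- A rectangle family (S , R), stored as its graph.
Family : Set
Family = List (ℕ × Rect)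

famLabels : Family → List ℕ
famLabels = map proj₁

toFamily : Perm → Family
toFamily π = map (λ e → proj₁ e ,
  ([ coord d₁ (proj₂ e) , coord d₁ (proj₂ e) ] ⊠
   [ coord d₂ (proj₂ e) , coord d₂ (proj₂ e) ])) (elems π)

removeTwo : ℕ → ℕ → Family → Family
removeTwo i j = filter (λ e → ¬? (proj₁ e ≟ i) ×-dec ¬? (proj₁ e ≟ j))

-- number of j ≠ i such that R(i), R(j) α-view each other
viewCount : Family → Dim → ℕ × Rect → ℕ
viewCount F α (i , R) = length (filter
  (λ e → ¬? (proj₁ e ≟ i) ×-dec
         ((lo (Iα α R) ⊔ lo (Iα α (proj₂ e))) ≤? (hi (Iα α R) ⊓ hi (Iα α (proj₂ e)))))
  F)

view : Family → ℕ × Rect → ℕ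
view F e = viewCount F d₁ e ⊔ viewCount F d₂ e

Wide : ℕ → Family → Set
Wide d F = All (λ e → view F e < d) F

-- Decomp d F m : a d-wide decomposition starting at family F in which
-- all new indices are > m (and strictly increasing).
data Decomp (d : ℕ) : Family → ℕ → Set where
  done : ∀ {F m} → Wide d F → length F ≡ 1 → Decomp d F m
  step : ∀ {F m} i j k Ri Rj →
         (i , Ri) ∈ F → (j , Rj) ∈ F → i ≢ j → m < k →
         Wide d F →
         Decomp d ((k , bbox Ri Rj) ∷ removeTwo i j F) k →
         Decomp d F m

maxLabel : Perm → ℕ
maxLabel π = foldr _⊔_ 0 (labels π)

HasWideDecomp : ℕ → Perm → Set
HasWideDecomp d π = Decomp d (toFamily π) (maxLabel π)

-- w(π) ≤ n  (w(π) = min d with a d-wide decomposition)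
WidthAtMost : Perm → ℕ → Set
WidthAtMost π n = Σ ℕ λ d → d ≤ n × HasWideDecomp d π

module Submission where

-- A family is 1-wide exactly when its rectangles are pairwise apart, i.e. no
-- two of them view each other in either coordinate (wide⇒apart, apart⇒wide).
--
-- (⇒) Separable permutations have the adjacent-pair property: every set T of
-- at least two labels contains distinct a, b with no member of T strictly
-- between them in either coordinate.  Monotone permutations have it (take the
-- two leftmost members) and substitution preserves it.  The greedy
-- decomposition keeps a pairwise apart family of rectangles, each containing a
-- point of π; it merges two rectangles whose chosen points are adjacent.  A
-- rectangle meeting their bounding box would lie between them (between-boxes),
-- so the new family is again pairwise apart, hence 1-wide.
--
-- (⇐) Along a 1-wide decomposition every rectangle R restricts π to a
-- separable permutation π|R, and the rectangles cover π.  When R and R′ are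
-- merged, apartness of the new family forces the points in their bounding box
-- to lie in R or R′, and π|bbox R R′ is τ[x ← π|R][y ← π|R′] for the two-point
-- pattern τ of R and R′ (block-substitution).  The last rectangle covers π.

open import Defs
open import Data.List using ([])
open import Relation.Binary.PropositionalEquality using (_≢_)
open import Function using (_⇔_)

open import Data.Nat using (ℕ; zero; suc; _+_; _<_; _≤_; _⊔_; _⊓_; _≟_; z≤n; s≤s)
open import Data.Nat.Properties
open import Relation.Binary.Definitions using (tri<; tri≈; tri>)
open import Data.Product using (Σ; _×_; _,_; proj₁; proj₂)
open import Data.Sum using (_⊎_; inj₁; inj₂)
open import Data.Empty using (⊥-elim)
open import Data.List using (List; _∷_; map; filter; length; foldr)
open import Data.List.Properties using (filter-notAll; filter-none; map-∘)
open import Data.List.Relation.Unary.All as All using (All; []; _∷_; lookup)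
open import Data.List.Relation.Unary.Any as Any using (Any; here; there; any?)
open import Data.List.Relation.Unary.Unique.Propositional using (Unique)
open import Data.List.Relation.Unary.AllPairs using ([]; _∷_)
import Data.List.Relation.Unary.AllPairs.Properties as AllPairs
open import Data.List.Relation.Binary.Subset.Propositional using (_⊆_)
open import Data.List.Membership.Propositional using (_∈_; _∉_; lose; find)
open import Data.List.Membership.Propositional.Properties using (∈-map⁺; ∈-map⁻; ∈-filter⁺; ∈-filter⁻)
open import Data.List.Membership.DecPropositional _≟_ using (_∈?_)
open import Relation.Binary.PropositionalEquality using (_≡_; refl; sym; trans; cong; cong₂)
import Relation.Binary.PropositionalEquality as ≡
open import Relation.Nullary using (¬_; ¬?; Dec; yes; no)
open import Relation.Nullary.Decidable using (_×-dec_)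
open import Relation.Unary using (Pred; Decidable)
open import Level using (0ℓ)
open import Function using (_∘_; case_of_; mk⇔; Equivalence)
open Equivalence using (to; from)

unique-map-injective : ∀ {A B : Set} (f : A → B) {xs : List A} → Unique (map f xs) →
                       ∀ {a b} → a ∈ xs → b ∈ xs → f a ≡ f b → a ≡ b
unique-map-injective f (u ∷ us) (here refl) (here refl) e = refl
unique-map-injective f (u ∷ us) (here refl) (there b∈) e  = ⊥-elim (lookup u (∈-map⁺ f b∈) e)
unique-map-injective f (u ∷ us) (there a∈) (here refl) e  = ⊥-elim (lookup u (∈-map⁺ f a∈) (sym e))
unique-map-injective f (u ∷ us) (there a∈) (there b∈) e   = unique-map-injective f us a∈ b∈ e

unique-map-filter : ∀ {A B : Set} (f : A → B) {P : Pred A 0ℓ} (P? : Decidable P) (xs : List A) →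
                    Unique (map f xs) → Unique (map f (filter P? xs))
unique-map-filter f P? xs u = AllPairs.map⁺ (AllPairs.filter⁺ P? (AllPairs.map⁻ u))

map-⊆ : ∀ {A B : Set} (f : A → B) {xs : List A} {L : List B} → (∀ {x} → x ∈ xs → f x ∈ L) → map f xs ⊆ L
map-⊆ f f∈ y∈ with ∈-map⁻ f y∈
... | _ , x∈ , refl = f∈ x∈

filter-drops-two : ∀ {A : Set} {P : Pred A 0ℓ} (P? : Decidable P) (xs : List A) {x y} →
                   x ∈ xs → y ∈ xs → x ≢ y → ¬ P x → ¬ P y →
                   2 + length (filter P? xs) ≤ length xs
filter-drops-two P? (z ∷ xs) (here refl) (here refl) x≢y _ _ = ⊥-elim (x≢y refl)
filter-drops-two P? (z ∷ xs) (here refl) (there y∈) _ ¬px ¬py with P? z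
... | yes pz = ⊥-elim (¬px pz)
... | no _   = s≤s (filter-notAll P? xs (lose y∈ ¬py))
filter-drops-two P? (z ∷ xs) (there x∈) (here refl) _ ¬px ¬py with P? z
... | yes pz = ⊥-elim (¬py pz)
... | no _   = s≤s (filter-notAll P? xs (lose x∈ ¬px))
filter-drops-two P? (z ∷ xs) (there x∈) (there y∈) x≢y ¬px ¬py with P? z
... | yes _ = s≤s (filter-drops-two P? xs x∈ y∈ x≢y ¬px ¬py)
... | no _  = m≤n⇒m≤1+n (filter-drops-two P? xs x∈ y∈ x≢y ¬px ¬py)

module _ (π : Perm) where

  general-position : ∀ α → Unique (map (coord α ∘ proj₂) (elems π))
  general-position d₁ = genPos₁ π
  general-position d₂ = genPos₂ π

  label∈ : ∀ {l P} → (l , P) ∈ elems π → l ∈ labels π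
  label∈ = ∈-map⁺ proj₁

  pointOf : ∀ {l} → l ∈ labels π → Σ Point λ P → (l , P) ∈ elems π
  pointOf l∈ with ∈-map⁻ proj₁ l∈
  ... | (_ , P) , e∈ , refl = P , e∈

  point-unique : ∀ {l P Q} → (l , P) ∈ elems π → (l , Q) ∈ elems π → P ≡ Q
  point-unique p q = cong proj₂ (unique-map-injective proj₁ (uniqueS π) p q refl)

  coord-injective : ∀ α {p q P Q} → (p , P) ∈ elems π → (q , Q) ∈ elems π →
                    coord α P ≡ coord α Q → p ≡ q
  coord-injective α p q e = cong proj₁ (unique-map-injective (coord α ∘ proj₂) (general-position α) p q e)

  Lt⇔coord : ∀ α {p q P Q} → (p , P) ∈ elems π → (q , Q) ∈ elems π →
             Lt π α p q ⇔ (coord α P < coord α Q)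
  Lt⇔coord α p∈ q∈ = mk⇔ forward (λ lt → _ , _ , p∈ , q∈ , lt)
    where
    forward : Lt π α _ _ → coord α _ < coord α _
    forward (_ , _ , p∈′ , q∈′ , lt) with point-unique p∈ p∈′ | point-unique q∈ q∈′
    ... | refl | refl = lt

  Lt-irrefl : ∀ α {p} → ¬ Lt π α p p
  Lt-irrefl α (_ , _ , p∈ , p∈′ , lt) with point-unique p∈ p∈′
  ... | refl = <-irrefl refl lt

  Lt-≢ : ∀ α {p q} → Lt π α p q → p ≢ q
  Lt-≢ α lt refl = Lt-irrefl α lt

  Lt-asym : ∀ α {p q} → Lt π α p q → ¬ Lt π α q p
  Lt-asym α (_ , _ , p∈ , q∈ , lt) qp = <-asym lt (to (Lt⇔coord α q∈ p∈) qp)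

  Lt-trans : ∀ α {p q r} → Lt π α p q → Lt π α q r → Lt π α p r
  Lt-trans α (P , _ , p∈ , q∈ , lt) (_ , R , q∈′ , r∈ , lt′) with point-unique q∈ q∈′
  ... | refl = P , R , p∈ , r∈ , <-trans lt lt′

  Lt-total : ∀ α {p q} → p ∈ labels π → q ∈ labels π → p ≢ q → Lt π α p q ⊎ Lt π α q p
  Lt-total α p∈ q∈ p≢q with pointOf p∈ | pointOf q∈
  ... | P , p∈′ | Q , q∈′ with <-cmp (coord α P) (coord α Q)
  ... | tri< lt _ _ = inj₁ (P , Q , p∈′ , q∈′ , lt)
  ... | tri≈ _ eq _ = ⊥-elim (p≢q (coord-injective α p∈′ q∈′ eq))
  ... | tri> _ _ gt = inj₂ (Q , P , q∈′ , p∈′ , gt)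

  ¬Lt⇒Lt : ∀ α {p q} → p ∈ labels π → q ∈ labels π → p ≢ q → ¬ Lt π α q p → Lt π α p q
  ¬Lt⇒Lt α p∈ q∈ p≢q ¬qp with Lt-total α p∈ q∈ p≢q
  ... | inj₁ pq = pq
  ... | inj₂ qp = ⊥-elim (¬qp qp)

Between : Perm → Dim → ℕ → ℕ → ℕ → Set
Between σ α c a b = (Lt σ α a c × Lt σ α c b) ⊎ (Lt σ α b c × Lt σ α c a)

PointBetween : Dim → Point → Point → Point → Set
PointBetween α C P Q = (coord α P < coord α C × coord α C < coord α Q) ⊎ (coord α Q < coord α C × coord α C < coord α P)

point-between : ∀ σ α {a b c P Q C} → (a , P) ∈ elems σ → (b , Q) ∈ elems σ → (c , C) ∈ elems σ →
                PointBetween α C P Q → Between σ α c a b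
point-between σ α a∈ b∈ c∈ (inj₁ (PC , CQ)) = inj₁ (from (Lt⇔coord σ α a∈ c∈) PC , from (Lt⇔coord σ α c∈ b∈) CQ)
point-between σ α a∈ b∈ c∈ (inj₂ (QC , CP)) = inj₂ (from (Lt⇔coord σ α b∈ c∈) QC , from (Lt⇔coord σ α c∈ a∈) CP)

TwoDistinct : List ℕ → Set
TwoDistinct T = Σ ℕ λ a → Σ ℕ λ b → a ∈ T × b ∈ T × a ≢ b

AdjacentPair : Perm → List ℕ → Set
AdjacentPair σ T = Σ ℕ λ a → Σ ℕ λ b → a ∈ T × b ∈ T × a ≢ b ×
                   (∀ {c} → c ∈ T → ∀ α → ¬ Between σ α c a b)

HasAdjacentPairs : Perm → Set
HasAdjacentPairs σ = ∀ T → T ⊆ labels σ → TwoDistinct T → AdjacentPair σ T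

minimum : ∀ σ α {T t} → T ⊆ labels σ → t ∈ T → Σ ℕ λ m → m ∈ T × (∀ {c} → c ∈ T → ¬ Lt σ α c m)
minimum σ α {t ∷ []} T⊆ _ = t , here refl , λ { (here refl) → Lt-irrefl σ α }
minimum σ α {t ∷ u ∷ T} T⊆ _ with minimum σ α {u ∷ T} (T⊆ ∘ there) (here refl)
... | m , m∈ , m-min with t ≟ m
...   | yes refl = m , here refl , λ { (here refl) → Lt-irrefl σ α ; (there c∈) → m-min c∈ }
...   | no t≢m with Lt-total σ α (T⊆ (here refl)) (T⊆ (there m∈)) t≢m
...     | inj₁ t<m = t , here refl , λ { (here refl) → Lt-irrefl σ α
                                      ; (there c∈) c<t → m-min c∈ (Lt-trans σ α c<t t<m) }
...     | inj₂ m<t = m , there m∈ , λ { (here refl) t<m → Lt-asym σ α t<m m<t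
                                     ; (there c∈) → m-min c∈ }

monotone-between : ∀ σ → Monotone σ → ∀ {a b c} → a ∈ labels σ → b ∈ labels σ → c ∈ labels σ →
                   Between σ d₂ c a b → Between σ d₁ c a b
monotone-between σ (inj₁ inc) a∈ b∈ c∈ (inj₁ (ac , cb)) =
  inj₁ (from (inc _ _ a∈ c∈) ac , from (inc _ _ c∈ b∈) cb)
monotone-between σ (inj₁ inc) a∈ b∈ c∈ (inj₂ (bc , ca)) =
  inj₂ (from (inc _ _ b∈ c∈) bc , from (inc _ _ c∈ a∈) ca)
monotone-between σ (inj₂ dec) a∈ b∈ c∈ (inj₁ (ac , cb)) =
  inj₂ (from (dec _ _ b∈ c∈) cb , from (dec _ _ c∈ a∈) ac)
monotone-between σ (inj₂ dec) a∈ b∈ c∈ (inj₂ (bc , ca)) =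
  inj₁ (from (dec _ _ a∈ c∈) ca , from (dec _ _ c∈ b∈) bc)

without : ℕ → List ℕ → List ℕ
without a = filter (λ t → ¬? (a ≟ t))

∈-without⁻ : ∀ {a t T} → t ∈ without a T → t ∈ T × a ≢ t
∈-without⁻ {a} {T = T} = ∈-filter⁻ (λ t → ¬? (a ≟ t)) {xs = T}

∈-without⁺ : ∀ {a t T} → t ∈ T → a ≢ t → t ∈ without a T
∈-without⁺ {a} = ∈-filter⁺ (λ t → ¬? (a ≟ t))

other-member : ∀ {T} → TwoDistinct T → ∀ a → Σ ℕ λ t → t ∈ without a T
other-member (a₀ , b₀ , a₀∈ , b₀∈ , a₀≢b₀) a with a ≟ a₀
... | yes refl  = b₀ , ∈-without⁺ b₀∈ a₀≢b₀
... | no  a≢a₀  = a₀ , ∈-without⁺ a₀∈ a≢a₀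

-- Monotone permutations: the two leftmost members of T are adjacent.
monotone-adjacent : ∀ σ → Monotone σ → HasAdjacentPairs σ
monotone-adjacent σ mon T T⊆ two@(_ , _ , a₀∈ , _) with minimum σ d₁ T⊆ a₀∈
... | a , a∈ , a-min with other-member two a
... | _ , t∈ with minimum σ d₁ (T⊆ ∘ proj₁ ∘ ∈-without⁻) t∈
... | b , b∈′ , b-min = a , b , a∈ , b∈ , a≢b , adjacent
  where
  b∈ = proj₁ (∈-without⁻ b∈′)
  a≢b = proj₂ (∈-without⁻ {T = T} b∈′)
  adjacent₁ : ∀ {c} → c ∈ T → ¬ Between σ d₁ c a b
  adjacent₁ c∈ (inj₁ (a<c , c<b)) = b-min (∈-without⁺ c∈ (Lt-≢ σ d₁ a<c)) c<b
  adjacent₁ c∈ (inj₂ (_ , c<a))   = a-min c∈ c<a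
  adjacent : ∀ {c} → c ∈ T → ∀ α → ¬ Between σ α c a b
  adjacent c∈ d₁ = adjacent₁ c∈
  adjacent c∈ d₂ = adjacent₁ c∈ ∘ monotone-between σ mon (T⊆ a∈) (T⊆ b∈) (T⊆ c∈)

adjacent-pullback : ∀ σ ρ (f : ℕ → ℕ) T → HasAdjacentPairs ρ → (∀ {u} → u ∈ T → f u ∈ labels ρ) →
                    (∀ {u v} → u ∈ T → v ∈ T → f u ≡ f v → u ≡ v) →
                    (∀ α {u v} → u ∈ T → v ∈ T → Lt σ α u v → Lt ρ α (f u) (f v)) →
                    TwoDistinct T → AdjacentPair σ T
adjacent-pullback σ ρ f T adjρ f∈ f-inj f-mono (a₀ , b₀ , a₀∈ , b₀∈ , a₀≢b₀)
  with adjρ (map f T) (map-⊆ f f∈)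
         (f a₀ , f b₀ , ∈-map⁺ f a₀∈ , ∈-map⁺ f b₀∈ , a₀≢b₀ ∘ f-inj a₀∈ b₀∈)
... | _ , _ , fa∈ , fb∈ , fa≢fb , adjacent with ∈-map⁻ f fa∈ | ∈-map⁻ f fb∈
... | a , a∈ , refl | b , b∈ , refl = a , b , a∈ , b∈ , fa≢fb ∘ cong f , pulled
  where
  pulled : ∀ {c} → c ∈ T → ∀ α → ¬ Between σ α c a b
  pulled c∈ α (inj₁ (ac , cb)) = adjacent (∈-map⁺ f c∈) α (inj₁ (f-mono α a∈ c∈ ac , f-mono α c∈ b∈ cb))
  pulled c∈ α (inj₂ (bc , ca)) = adjacent (∈-map⁺ f c∈) α (inj₂ (f-mono α b∈ c∈ bc , f-mono α c∈ a∈ ca))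

two-distinct? : ∀ T → TwoDistinct T ⊎ (∀ {a b} → a ∈ T → b ∈ T → a ≡ b)
two-distinct? [] = inj₂ λ ()
two-distinct? (u ∷ T) with any? (λ v → ¬? (v ≟ u)) T
... | yes some = let v , v∈ , v≢u = find some in
                 inj₁ (v , u , there v∈ , here refl , v≢u)
... | no none = inj₂ λ a∈ b∈ → trans (is-u a∈) (sym (is-u b∈))
  where
  is-u : ∀ {a} → a ∈ u ∷ T → a ≡ u
  is-u (here refl) = refl
  is-u {a} (there a∈) with a ≟ u
  ... | yes a≡u = a≡u
  ... | no a≢u  = ⊥-elim (none (lose a∈ a≢u))

module Substitution {π x π′ σ} (S : IsSubst π x π′ σ) (adjπ : HasAdjacentPairs π)
                    (adjπ′ : HasAdjacentPairs π′) where
  open IsSubst S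

  outer : ∀ {c} → c ∈ labels σ → c ∉ labels π′ → c ∈ labels π × c ≢ x
  outer c∈ c∉ with to (support _) c∈
  ... | inj₁ c-outer = c-outer
  ... | inj₂ c-inner = ⊥-elim (c∉ c-inner)

  collapse : ℕ → ℕ
  collapse c with c ∈? labels π′
  ... | yes _ = x
  ... | no _  = c

  collapse∈ : ∀ {c} → c ∈ labels σ → collapse c ∈ labels π
  collapse∈ {c} c∈ with c ∈? labels π′
  ... | yes _  = x∈S
  ... | no c∉  = proj₁ (outer c∈ c∉)

  collapse-injective : ∀ {u v} → u ∈ labels σ → v ∈ labels σ → collapse u ≡ collapse v →
                       u ≡ v ⊎ (u ∈ labels π′ × v ∈ labels π′)
  collapse-injective {u} {v} u∈ v∈ e with u ∈? labels π′ | v ∈? labels π′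
  ... | yes u′ | yes v′ = inj₂ (u′ , v′)
  ... | no _   | no _   = inj₁ e
  ... | yes _  | no v∉  = ⊥-elim (proj₂ (outer v∈ v∉) (sym e))
  ... | no u∉  | yes _  = ⊥-elim (proj₂ (outer u∈ u∉) e)

  inner-vs-outer : ∀ α {u c} → u ∈ labels σ → u ∈ labels π′ → c ∈ labels σ → c ∉ labels π′ →
                   Lt σ α u c → Lt π α x c
  inner-vs-outer α u∈ u′ c∈ c∉ u<c with outer c∈ c∉
  ... | cπ , c≢x = ¬Lt⇒Lt π α x∈S cπ (c≢x ∘ sym)
                     (λ c<x → Lt-asym σ α u<c (from (across α _ _ cπ c≢x u′) c<x))

  collapse-Lt : ∀ α {u v} → u ∈ labels σ → v ∈ labels σ → collapse u ≢ collapse v →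
                Lt σ α u v → Lt π α (collapse u) (collapse v)
  collapse-Lt α {u} {v} u∈ v∈ ne u<v with u ∈? labels π′ | v ∈? labels π′
  ... | yes _  | yes _  = ⊥-elim (ne refl)
  ... | no u∉  | no v∉  = let (uπ , u≢x) = outer u∈ u∉ ; (vπ , v≢x) = outer v∈ v∉ in
                          to (agreeπ α u v uπ u≢x vπ v≢x) u<v
  ... | no u∉  | yes v′ = let (uπ , u≢x) = outer u∈ u∉ in to (across α u v uπ u≢x v′) u<v
  ... | yes u′ | no v∉  = inner-vs-outer α u∈ u′ v∈ v∉ u<v

  inner : List ℕ → List ℕ
  inner = filter (_∈? labels π′)

  ∈-inner⁻ : ∀ {c T} → c ∈ inner T → c ∈ T × c ∈ labels π′
  ∈-inner⁻ {T = T} = ∈-filter⁻ (_∈? labels π′) {xs = T}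

  ∈-inner⁺ : ∀ {c T} → c ∈ T → c ∈ labels π′ → c ∈ inner T
  ∈-inner⁺ = ∈-filter⁺ (_∈? labels π′)

  -- Case 1: T has two labels of π′; an adjacent pair of those is adjacent in T,
  -- since outer labels see both of them on the same side.
  adjacent-inner : ∀ T → T ⊆ labels σ → TwoDistinct (inner T) → AdjacentPair σ T
  adjacent-inner T T⊆ two
    with adjacent-pullback σ π′ (λ c → c) (inner T) adjπ′ (proj₂ ∘ ∈-inner⁻ {T = T}) (λ _ _ e → e)
           (λ α u∈ v∈ → to (agreeπ' α _ _ (proj₂ (∈-inner⁻ {T = T} u∈)) (proj₂ (∈-inner⁻ {T = T} v∈)))) two
  ... | a , b , a∈ , b∈ , a≢b , adjacent =
    a , b , proj₁ (∈-inner⁻ {T = T} a∈) , proj₁ (∈-inner⁻ {T = T} b∈) , a≢b , adjacent′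
    where
    a′ = proj₂ (∈-inner⁻ {T = T} a∈)
    b′ = proj₂ (∈-inner⁻ {T = T} b∈)
    adjacent′ : ∀ {c} → c ∈ T → ∀ α → ¬ Between σ α c a b
    adjacent′ {c} c∈ α btw with c ∈? labels π′
    ... | yes c′ = adjacent (∈-inner⁺ c∈ c′) α btw
    ... | no c∉ with outer (T⊆ c∈) c∉ | btw
    ...   | cπ , c≢x | inj₁ (a<c , c<b) =
            Lt-asym σ α a<c (from (across α c a cπ c≢x a′) (to (across α c b cπ c≢x b′) c<b))
    ...   | cπ , c≢x | inj₂ (b<c , c<a) =
            Lt-asym σ α b<c (from (across α c b cπ c≢x b′) (to (across α c a cπ c≢x a′) c<a))

  -- Case 2: T has at most one label of π′; collapsing is injective on T.
  adjacent-outer : ∀ T → T ⊆ labels σ → (∀ {a b} → a ∈ inner T → b ∈ inner T → a ≡ b) →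
                   TwoDistinct T → AdjacentPair σ T
  adjacent-outer T T⊆ one-inner =
    adjacent-pullback σ π collapse T adjπ (collapse∈ ∘ T⊆) injective
      (λ α u∈ v∈ u<v → collapse-Lt α (T⊆ u∈) (T⊆ v∈) (Lt-≢ σ α u<v ∘ injective u∈ v∈) u<v)
    where
    injective : ∀ {u v} → u ∈ T → v ∈ T → collapse u ≡ collapse v → u ≡ v
    injective u∈ v∈ e with collapse-injective (T⊆ u∈) (T⊆ v∈) e
    ... | inj₁ u≡v       = u≡v
    ... | inj₂ (u′ , v′) = one-inner (∈-inner⁺ u∈ u′) (∈-inner⁺ v∈ v′)

  substitution-adjacent : HasAdjacentPairs σ
  substitution-adjacent T T⊆ two with two-distinct? (inner T)
  ... | inj₁ two-inner = adjacent-inner T T⊆ two-inner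
  ... | inj₂ one-inner = adjacent-outer T T⊆ one-inner two

separable-adjacent : ∀ {σ} → Separable σ → HasAdjacentPairs σ
separable-adjacent {σ} (mono m) = monotone-adjacent σ m
separable-adjacent (subst {π} {π′} {σ} x sπ sπ′ S) =
  Substitution.substitution-adjacent {π} {x} {π′} {σ} S (separable-adjacent sπ) (separable-adjacent sπ′)

InI : ℕ → Interval → Set
InI v I = lo I ≤ v × v ≤ hi I

ProperI : Interval → Set
ProperI I = lo I ≤ hi I

meet-intro : ∀ {v I J} → InI v I → InI v J → IntersectsNonempty I J
meet-intro (lI , hI) (lJ , hJ) =
  ⊔-lub (⊓-glb (≤-trans lI hI) (≤-trans lI hJ)) (⊓-glb (≤-trans lJ hI) (≤-trans lJ hJ))

meet-sym : ∀ {I J} → IntersectsNonempty I J → IntersectsNonempty J I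
meet-sym {I} {J} h rewrite ⊔-comm (lo J) (lo I) | ⊓-comm (hi J) (hi I) = h

meet-bounds : ∀ {I J} → IntersectsNonempty I J → lo I ≤ hi J × lo J ≤ hi I
meet-bounds {I} {J} h = ≤-trans (m≤m⊔n (lo I) (lo J)) (≤-trans h (m⊓n≤n (hi I) (hi J))) ,
                        ≤-trans (m≤n⊔m (lo I) (lo J)) (≤-trans h (m⊓n≤m (hi I) (hi J)))

apart-order : ∀ {I J} → ProperI I → ProperI J → ¬ IntersectsNonempty I J →
              hi I < lo J ⊎ hi J < lo I
apart-order {I} {J} pI pJ ¬meet with lo J ≤? hi I | lo I ≤? hi J
... | no  J≰I | _       = inj₁ (≰⇒> J≰I)
... | yes _   | no  I≰J = inj₂ (≰⇒> I≰J)
... | yes J≤I | yes I≤J = ⊥-elim (¬meet (⊔-lub (⊓-glb pI I≤J) (⊓-glb J≤I pJ)))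

before : ∀ {u v I J} → InI u I → InI v J → hi I < lo J → u < v
before (_ , u≤) (≤v , _) I<J = ≤-<-trans u≤ (<-≤-trans I<J ≤v)

hull : Interval → Interval → Interval
hull I J = [ lo I ⊓ lo J , hi I ⊔ hi J ]

in-hullˡ : ∀ {v I J} → InI v I → InI v (hull I J)
in-hullˡ {v} {I} {J} (l , h) = ≤-trans (m⊓n≤m (lo I) (lo J)) l , ≤-trans h (m≤m⊔n (hi I) (hi J))

in-hullʳ : ∀ {v I J} → InI v J → InI v (hull I J)
in-hullʳ {v} {I} {J} (l , h) = ≤-trans (m⊓n≤n (lo I) (lo J)) l , ≤-trans h (m≤n⊔m (hi I) (hi J))

hull-proper : ∀ {I J} → ProperI I → ProperI J → ProperI (hull I J)
hull-proper {I} {J} pI _ = ≤-trans (m⊓n≤m (lo I) (lo J)) (≤-trans pI (m≤m⊔n (hi I) (hi J)))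

between-hull : ∀ {I J K} → ProperI I → ProperI J → ProperI K →
               ¬ IntersectsNonempty I K → ¬ IntersectsNonempty J K → IntersectsNonempty K (hull I J) →
               (hi I < lo K × hi K < lo J) ⊎ (hi J < lo K × hi K < lo I)
between-hull pI pJ pK ¬IK ¬JK meet with meet-bounds meet | apart-order pI pK ¬IK | apart-order pJ pK ¬JK
... | K≤ , _ | inj₁ I<K | inj₁ J<K = ⊥-elim (<⇒≱ (⊔-lub I<K J<K) K≤)
... | _ , ≤K | inj₂ K<I | inj₂ K<J = ⊥-elim (<⇒≱ (⊓-glb K<I K<J) ≤K)
... | _      | inj₁ I<K | inj₂ K<J = inj₁ (I<K , K<J)
... | _      | inj₂ K<I | inj₁ J<K = inj₂ (J<K , K<I)

InBox : Point → Rect → Set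
InBox P R = InI (coord d₁ P) (I₁ R) × InI (coord d₂ P) (I₂ R)

inBox-coord : ∀ {P R} → InBox P R → ∀ α → InI (coord α P) (Iα α R)
inBox-coord b d₁ = proj₁ b
inBox-coord b d₂ = proj₂ b

inBox? : ∀ P R → Dec (InBox P R)
inBox? P R = ((lo (I₁ R) ≤? proj₁ P) ×-dec (proj₁ P ≤? hi (I₁ R))) ×-dec
             ((lo (I₂ R) ≤? proj₂ P) ×-dec (proj₂ P ≤? hi (I₂ R)))

ProperR : Rect → Set
ProperR R = ∀ α → ProperI (Iα α R)

Apart : Rect → Rect → Set
Apart R R′ = ∀ α → ¬ IntersectsNonempty (Iα α R) (Iα α R′)

apart-sym : ∀ {R R′} → Apart R R′ → Apart R′ R
apart-sym {R} {R′} apart α = apart α ∘ meet-sym {Iα α R′} {Iα α R}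

Iα-bbox : ∀ α R R′ → Iα α (bbox R R′) ≡ hull (Iα α R) (Iα α R′)
Iα-bbox d₁ R R′ = refl
Iα-bbox d₂ R R′ = refl

bbox-proper : ∀ {R R′} → ProperR R → ProperR R′ → ProperR (bbox R R′)
bbox-proper p p′ d₁ = hull-proper (p d₁) (p′ d₁)
bbox-proper p p′ d₂ = hull-proper (p d₂) (p′ d₂)

inBox-bboxˡ : ∀ {P R R′} → InBox P R → InBox P (bbox R R′)
inBox-bboxˡ (b₁ , b₂) = in-hullˡ b₁ , in-hullˡ b₂

inBox-bboxʳ : ∀ {P R R′} → InBox P R′ → InBox P (bbox R R′)
inBox-bboxʳ (b₁ , b₂) = in-hullʳ b₁ , in-hullʳ b₂

apart-coord : ∀ {R R′ P Q} → Apart R R′ → InBox P R → InBox Q R′ → ∀ α → coord α P ≢ coord α Q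
apart-coord apart bP bQ α eq =
  apart α (meet-intro (inBox-coord bP α) (≡.subst (λ v → InI v _) (sym eq) (inBox-coord bQ α)))

apart-side : ∀ {R R′ P Q Q′} → ProperR R → ProperR R′ → Apart R R′ →
             InBox P R → InBox Q R′ → InBox Q′ R′ →
             ∀ α → (coord α P < coord α Q) ⇔ (coord α P < coord α Q′)
apart-side p p′ apart bP bQ bQ′ α with apart-order (p α) (p′ α) (apart α)
... | inj₁ R<R′ = mk⇔ (λ _ → before (inBox-coord bP α) (inBox-coord bQ′ α) R<R′)
                      (λ _ → before (inBox-coord bP α) (inBox-coord bQ α) R<R′)
... | inj₂ R′<R = mk⇔ (λ lt → ⊥-elim (<-asym lt (before (inBox-coord bQ α) (inBox-coord bP α) R′<R)))
                      (λ lt → ⊥-elim (<-asym lt (before (inBox-coord bQ′ α) (inBox-coord bP α) R′<R)))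

pointRect : Point → Rect
pointRect P = [ coord d₁ P , coord d₁ P ] ⊠ [ coord d₂ P , coord d₂ P ]

inBox-pointRect : ∀ P → InBox P (pointRect P)
inBox-pointRect P = (≤-refl , ≤-refl) , (≤-refl , ≤-refl)

pointRect-meet : ∀ α {P Q} → IntersectsNonempty (Iα α (pointRect P)) (Iα α (pointRect Q)) → coord α P ≡ coord α Q
pointRect-meet d₁ meet = let P≤Q , Q≤P = meet-bounds meet in ≤-antisym P≤Q Q≤P
pointRect-meet d₂ meet = let P≤Q , Q≤P = meet-bounds meet in ≤-antisym P≤Q Q≤P

pointRect-proper : ∀ P → ProperR (pointRect P)
pointRect-proper P d₁ = ≤-refl
pointRect-proper P d₂ = ≤-refl

PairwiseApart : Family → Set
PairwiseApart F = ∀ {e e′} → e ∈ F → e′ ∈ F → proj₁ e ≢ proj₁ e′ → Apart (proj₂ e) (proj₂ e′)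

∈⇒length-pos : ∀ {A : Set} {x : A} {xs} → x ∈ xs → 0 < length xs
∈⇒length-pos (here _)  = s≤s z≤n
∈⇒length-pos (there _) = s≤s z≤n

wide⇒apart : ∀ {d} F → d ≤ 1 → Wide d F → PairwiseApart F
wide⇒apart F d≤1 wide {i , R} {j , R′} e∈ e′∈ i≢j α meet =
  <-irrefl (sym (no-view α)) (∈⇒length-pos (∈-filter⁺ _ e′∈ ((i≢j ∘ sym) , meet)))
  where
  view<1 = ≤-trans (lookup wide e∈) d≤1
  no-view : ∀ α → viewCount F α (i , R) ≡ 0
  no-view d₁ = n≤0⇒n≡0 (≤-trans (m≤m⊔n _ (viewCount F d₂ (i , R))) (≤-pred view<1))
  no-view d₂ = n≤0⇒n≡0 (≤-trans (m≤n⊔m (viewCount F d₁ (i , R)) _) (≤-pred view<1))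

apart⇒wide : ∀ F → PairwiseApart F → Wide 1 F
apart⇒wide F apart = All.tabulate λ {(i , R)} e∈ →
  s≤s (≤-reflexive (cong₂ _⊔_ (no-view e∈ d₁) (no-view e∈ d₂)))
  where
  no-view : ∀ {i R} → (i , R) ∈ F → ∀ α → viewCount F α (i , R) ≡ 0
  no-view e∈ α = cong length (filter-none _ {xs = F} (All.tabulate λ e′∈ (i≢j , meet) →
                   apart e∈ e′∈ (i≢j ∘ sym) α meet))

merge : ℕ → ℕ → ℕ → Rect → Rect → Family → Family
merge i j k Ri Rj F = (k , bbox Ri Rj) ∷ removeTwo i j F

module _ {i j : ℕ} {F : Family} where

  ∈-removeTwo⁻ : ∀ {e} → e ∈ removeTwo i j F → e ∈ F × proj₁ e ≢ i × proj₁ e ≢ j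
  ∈-removeTwo⁻ = ∈-filter⁻ _ {xs = F}

  ∈-removeTwo⁺ : ∀ {e} → e ∈ F → proj₁ e ≢ i → proj₁ e ≢ j → e ∈ removeTwo i j F
  ∈-removeTwo⁺ e∈ e≢i e≢j = ∈-filter⁺ _ e∈ (e≢i , e≢j)

  merge-shorter : ∀ {k Ri Rj} → (i , Ri) ∈ F → (j , Rj) ∈ F → i ≢ j →
                  length (merge i j k Ri Rj F) < length F
  merge-shorter i∈ j∈ i≢j =
    filter-drops-two _ F i∈ j∈ (i≢j ∘ cong proj₁) (λ p → proj₁ p refl) (λ p → proj₂ p refl)

  all-merge : ∀ {P : ℕ × Rect → Set} {k R} → All P F → P (k , R) →
              All P ((k , R) ∷ removeTwo i j F)
  all-merge all new = new ∷ All.tabulate (lookup all ∘ proj₁ ∘ ∈-removeTwo⁻)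

record Tidy (F : Family) (m : ℕ) : Set where
  field
    distinct : Unique (famLabels F)
    bounded  : All (λ e → proj₁ e ≤ m) F
    proper   : All (ProperR ∘ proj₂) F

  rect-unique : ∀ {l R R′} → (l , R) ∈ F → (l , R′) ∈ F → R ≡ R′
  rect-unique e∈ e′∈ = cong proj₂ (unique-map-injective proj₁ distinct e∈ e′∈ refl)

  fresh-index : ∀ {k e} → m < k → e ∈ F → proj₁ e ≢ k
  fresh-index m<k e∈ refl = <⇒≱ m<k (lookup bounded e∈)
open Tidy

tidy-merge : ∀ {F m i j k Ri Rj} → Tidy F m → (i , Ri) ∈ F → (j , Rj) ∈ F → m < k →
             Tidy (merge i j k Ri Rj F) k
tidy-merge {F} {i = i} {j} t i∈ j∈ m<k = record
  { distinct = All.tabulate k-new ∷ unique-map-filter proj₁ _ F (distinct t)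
  ; bounded  = all-merge (All.map (λ l≤m → ≤-trans l≤m (<⇒≤ m<k)) (bounded t)) ≤-refl
  ; proper   = all-merge (proper t) (bbox-proper (lookup (proper t) i∈) (lookup (proper t) j∈))
  }
  where
  k-new : ∀ {l} → l ∈ famLabels (removeTwo i j F) → _ ≢ l
  k-new l∈ k≡l with ∈-map⁻ proj₁ l∈
  ... | e , e∈ , refl = fresh-index t m<k (proj₁ (∈-removeTwo⁻ e∈)) (sym k≡l)

≤-maxLabel : ∀ {l} xs → l ∈ xs → l ≤ foldr _⊔_ 0 xs
≤-maxLabel (x ∷ xs) (here refl) = m≤m⊔n x _
≤-maxLabel (x ∷ xs) (there l∈)  = ≤-trans (≤-maxLabel xs l∈) (m≤n⊔m x _)

∈-toFamily⁻ : ∀ π {e} → e ∈ toFamily π →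
              Σ (ℕ × Point) λ p → p ∈ elems π × e ≡ (proj₁ p , pointRect (proj₂ p))
∈-toFamily⁻ π e∈ = ∈-map⁻ _ e∈

∈-toFamily⁺ : ∀ π {l P} → (l , P) ∈ elems π → (l , pointRect P) ∈ toFamily π
∈-toFamily⁺ π = ∈-map⁺ _

tidy-init : ∀ π → Tidy (toFamily π) (maxLabel π)
tidy-init π = record
  { distinct = ≡.subst Unique (map-∘ (elems π)) (uniqueS π)
  ; bounded  = All.tabulate λ e∈ → case ∈-toFamily⁻ π e∈ of λ where
      (p , p∈ , refl) → ≤-maxLabel (labels π) (label∈ π p∈)
  ; proper   = All.tabulate λ e∈ → case ∈-toFamily⁻ π e∈ of λ where
      (p , p∈ , refl) → pointRect-proper (proj₂ p)
  }

apart-merge : ∀ {F i j k Ri Rj} → PairwiseApart F →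
              (∀ {l R} → (l , R) ∈ F → l ≢ i → l ≢ j → Apart R (bbox Ri Rj)) →
              PairwiseApart (merge i j k Ri Rj F)
apart-merge apart hull-apart (here refl) (here refl) k≢k = ⊥-elim (k≢k refl)
apart-merge apart hull-apart (here refl) (there e∈) _ =
  let e∈F , e≢i , e≢j = ∈-removeTwo⁻ e∈ in apart-sym (hull-apart e∈F e≢i e≢j)
apart-merge apart hull-apart (there e∈) (here refl) _ =
  let e∈F , e≢i , e≢j = ∈-removeTwo⁻ e∈ in hull-apart e∈F e≢i e≢j
apart-merge apart hull-apart (there e∈) (there e′∈) =
  apart (proj₁ (∈-removeTwo⁻ e∈)) (proj₁ (∈-removeTwo⁻ e′∈))

between-boxes : ∀ {Ri Rj R P Q C} α → ProperR Ri → ProperR Rj → ProperR R →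
                Apart Ri R → Apart Rj R → IntersectsNonempty (Iα α R) (Iα α (bbox Ri Rj)) →
                InBox P Ri → InBox Q Rj → InBox C R → PointBetween α C P Q
between-boxes {Ri} {Rj} {R} α pi pj p ai aj meet bP bQ bC
  with between-hull (pi α) (pj α) (p α) (ai α) (aj α)
         (≡.subst (IntersectsNonempty (Iα α R)) (Iα-bbox α Ri Rj) meet)
... | inj₁ (i<R , R<j) = inj₁ (before (inBox-coord bP α) (inBox-coord bC α) i<R ,
                              before (inBox-coord bC α) (inBox-coord bQ α) R<j)
... | inj₂ (j<R , R<i) = inj₂ (before (inBox-coord bQ α) (inBox-coord bC α) j<R ,
                              before (inBox-coord bC α) (inBox-coord bP α) R<i)

Occupied : Perm → Rect → Set
Occupied π R = Any (λ e → InBox (proj₂ e) R) (elems π)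

pointRect-occupied : ∀ π {p} → p ∈ elems π → Occupied π (pointRect (proj₂ p))
pointRect-occupied π {p} = Any.map λ { refl → inBox-pointRect (proj₂ p) }

restrict : Perm → Rect → Perm
restrict π R = record
  { elems    = filter (λ e → inBox? (proj₂ e) R) (elems π)
  ; positive = All.tabulate (lookup (positive π) ∘ proj₁ ∘ ∈-filter⁻ _ {xs = elems π})
  ; uniqueS  = unique-map-filter proj₁ _ (elems π) (uniqueS π)
  ; genPos₁  = unique-map-filter (coord d₁ ∘ proj₂) _ (elems π) (genPos₁ π)
  ; genPos₂  = unique-map-filter (coord d₂ ∘ proj₂) _ (elems π) (genPos₂ π)
  }

module _ (π : Perm) (R : Rect) where

  ∈-restrict⁻ : ∀ {l P} → (l , P) ∈ elems (restrict π R) → (l , P) ∈ elems π × InBox P R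
  ∈-restrict⁻ = ∈-filter⁻ _ {xs = elems π}

  ∈-restrict⁺ : ∀ {l P} → (l , P) ∈ elems π → InBox P R → (l , P) ∈ elems (restrict π R)
  ∈-restrict⁺ = ∈-filter⁺ _

  label-restrict⁻ : ∀ {l} → l ∈ labels (restrict π R) → Σ Point λ P → (l , P) ∈ elems π × InBox P R
  label-restrict⁻ l∈ = let P , p∈ = pointOf (restrict π R) l∈ in P , ∈-restrict⁻ p∈

module Greedy (π : Perm) (adjacent-pairs : HasAdjacentPairs π) where

  record Invariant (F : Family) (m : ℕ) : Set where
    field
      tidy     : Tidy F m
      apart    : PairwiseApart F
      occupied : All (Occupied π ∘ proj₂) F
  open Invariant

  rep : Rect → ℕ
  rep R with any? (λ e → inBox? (proj₂ e) R) (elems π)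
  ... | yes occ = proj₁ (proj₁ (find occ))
  ... | no _    = 0

  rep-spec : ∀ {R} → Occupied π R → Σ Point λ P → (rep R , P) ∈ elems π × InBox P R
  rep-spec {R} occ with any? (λ e → inBox? (proj₂ e) R) (elems π)
  ... | yes occ′ = let (_ , P) , p∈ , inR = find occ′ in P , p∈ , inR
  ... | no ¬occ  = ⊥-elim (¬occ occ)

  representatives : Family → List ℕ
  representatives = map (rep ∘ proj₂)

  module Step {F m} (inv : Invariant F m) where

    rep-of : ∀ {e} → e ∈ F → Σ Point λ P → (rep (proj₂ e) , P) ∈ elems π × InBox P (proj₂ e)
    rep-of e∈ = rep-spec (lookup (occupied inv) e∈)

    representatives⊆ : representatives F ⊆ labels π
    representatives⊆ r∈ with ∈-map⁻ (rep ∘ proj₂) r∈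
    ... | e , e∈ , refl = label∈ π (proj₁ (proj₂ (rep-of e∈)))

    rep-distinct : ∀ {e e′} → e ∈ F → e′ ∈ F → proj₁ e ≢ proj₁ e′ → rep (proj₂ e) ≢ rep (proj₂ e′)
    rep-distinct e∈ e′∈ l≢l′ eq with rep-of e∈ | rep-of e′∈
    ... | P , p∈ , inR | Q , q∈ , inR′ rewrite eq with point-unique π p∈ q∈
    ...   | refl = apart-coord (apart inv e∈ e′∈ l≢l′) inR inR′ d₁ refl

    record MergeablePair : Set where
      field
        i j : ℕ
        Ri Rj : Rect
        i∈ : (i , Ri) ∈ F
        j∈ : (j , Rj) ∈ F
        i≢j : i ≢ j
        hull-apart : ∀ {l R} → (l , R) ∈ F → l ≢ i → l ≢ j → Apart R (bbox Ri Rj)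

    -- when F has two rectangles, those with adjacent representatives are
    -- mergeable: a rectangle meeting their bounding box would hold a
    -- representative between them
    mergeable-pair : ∀ {e₁ e₂} → e₁ ∈ F → e₂ ∈ F → proj₁ e₁ ≢ proj₁ e₂ → MergeablePair
    mergeable-pair e₁∈ e₂∈ l₁≢l₂
      with adjacent-pairs (representatives F) representatives⊆
             (_ , _ , ∈-map⁺ _ e₁∈ , ∈-map⁺ _ e₂∈ , rep-distinct e₁∈ e₂∈ l₁≢l₂)
    ... | a , b , a∈ , b∈ , a≢b , adjacent with ∈-map⁻ (rep ∘ proj₂) a∈ | ∈-map⁻ (rep ∘ proj₂) b∈
    ... | (i , Ri) , i∈ , refl | (j , Rj) , j∈ , refl = record
      { i∈ = i∈ ; j∈ = j∈ ; i≢j = i≢j ; hull-apart = hull-apart }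
      where
      i≢j : i ≢ j
      i≢j refl = a≢b (cong rep (rect-unique (tidy inv) i∈ j∈))
      proper′ = lookup (proper (tidy inv))
      hull-apart : ∀ {l R} → (l , R) ∈ F → l ≢ i → l ≢ j → Apart R (bbox Ri Rj)
      hull-apart {l} {R} l∈ l≢i l≢j α meet with rep-of i∈ | rep-of j∈ | rep-of l∈
      ... | P , p∈ , inRi | Q , q∈ , inRj | C , c∈ , inR =
        adjacent (∈-map⁺ (rep ∘ proj₂) l∈) α (point-between π α p∈ q∈ c∈
          (between-boxes α (proper′ i∈) (proper′ j∈) (proper′ l∈)
            (apart inv i∈ l∈ (l≢i ∘ sym)) (apart inv j∈ l∈ (l≢j ∘ sym)) meet inRi inRj inR))

    merge-invariant : (pair : MergeablePair) → let open MergeablePair pair in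
                      Invariant (merge i j (suc m) Ri Rj F) (suc m)
    merge-invariant pair = record
      { tidy     = tidy-merge (tidy inv) i∈ j∈ ≤-refl
      ; apart    = apart-merge {Ri = Ri} {Rj} (apart inv) hull-apart
      ; occupied = all-merge (occupied inv) (Any.map inBox-bboxˡ (lookup (occupied inv) i∈))
      }
      where open MergeablePair pair

  decompose : ∀ n {F m} → length F ≤ suc n → F ≢ [] → Invariant F m → Decomp 1 F m
  decompose _ {[]} _ F≢[] _ = ⊥-elim (F≢[] refl)
  decompose _ {_ ∷ []} _ _ inv = done (apart⇒wide _ (apart inv)) refl
  decompose zero {_ ∷ _ ∷ _} (s≤s ()) _ _
  decompose (suc n) {F@(e₁ ∷ e₂ ∷ _)} {m} F≤ _ inv =
    step i j (suc m) Ri Rj i∈ j∈ i≢j ≤-refl (apart⇒wide F (apart inv))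
      (decompose n (≤-pred (≤-trans (merge-shorter {k = suc m} i∈ j∈ i≢j) F≤)) (λ ()) (merge-invariant pair))
    where
    open Step inv
    e₁≢e₂ : proj₁ e₁ ≢ proj₁ e₂
    e₁≢e₂ with distinct (tidy inv)
    ... | e₁-fresh ∷ _ = lookup e₁-fresh (here refl)
    pair = mergeable-pair (here refl) (there (here refl)) e₁≢e₂
    open MergeablePair pair

  initial : Invariant (toFamily π) (maxLabel π)
  initial = record
    { tidy     = tidy-init π
    ; apart    = points-apart
    ; occupied = All.tabulate λ e∈ → case ∈-toFamily⁻ π e∈ of λ where
        (p , p∈ , refl) → pointRect-occupied π p∈
    }
    where
    points-apart : PairwiseApart (toFamily π)
    points-apart e∈ e′∈ l≢l′ α meet with ∈-toFamily⁻ π e∈ | ∈-toFamily⁻ π e′∈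
    ... | p , p∈ , refl | q , q∈ , refl =
      l≢l′ (coord-injective π α p∈ q∈ (pointRect-meet α meet))

adjacent⇒narrow : ∀ π → elems π ≢ [] → HasAdjacentPairs π → WidthAtMost π 1
adjacent⇒narrow π π≢[] adj =
  1 , ≤-refl , decompose (length (toFamily π)) (n≤1+n _) (nonempty π≢[]) initial
  where
  open Greedy π adj
  nonempty : ∀ {A B : Set} {f : A → B} {xs} → xs ≢ [] → map f xs ≢ []
  nonempty {xs = []} xs≢[] _ = xs≢[] refl
  nonempty {xs = _ ∷ _} _ ()

-- Permutations with the same graph have the same labels and orders, so
-- separability only depends on the set of entries.
SamePoints : Perm → Perm → Set
SamePoints σ τ = ∀ {l P} → (l , P) ∈ elems σ ⇔ (l , P) ∈ elems τ

_⟨⇔⟩_ : ∀ {A B C : Set} → A ⇔ B → B ⇔ C → A ⇔ C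
f ⟨⇔⟩ g = mk⇔ (to g ∘ to f) (from f ∘ from g)

⇔-sym : ∀ {A B : Set} → A ⇔ B → B ⇔ A
⇔-sym f = mk⇔ (from f) (to f)

module _ {σ τ : Perm} (same : SamePoints σ τ) where

  same-labels : ∀ {l} → l ∈ labels σ → l ∈ labels τ
  same-labels l∈ = let P , p∈ = pointOf σ l∈ in label∈ τ (to same p∈)

  same-Lt : ∀ α {p q} → Lt σ α p q → Lt τ α p q
  same-Lt α (P , Q , p∈ , q∈ , lt) = P , Q , to same p∈ , to same q∈ , lt

separable-same-points : ∀ {σ τ} → SamePoints σ τ → Separable σ → Separable τ
separable-same-points {σ} {τ} same = transport
  where
  back : SamePoints τ σ
  back = ⇔-sym same
  labels⇔ : ∀ l → l ∈ labels τ ⇔ l ∈ labels σ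
  labels⇔ l = mk⇔ (same-labels {τ} {σ} back) (same-labels {σ} {τ} same)
  Lt⇔ : ∀ α p q → Lt τ α p q ⇔ Lt σ α p q
  Lt⇔ α p q = mk⇔ (same-Lt {τ} {σ} back α) (same-Lt {σ} {τ} same α)
  transport : Separable σ → Separable τ
  transport (mono (inj₁ inc)) = mono (inj₁ λ p q p∈ q∈ →
    Lt⇔ d₁ p q ⟨⇔⟩ (inc p q (to (labels⇔ p) p∈) (to (labels⇔ q) q∈) ⟨⇔⟩ ⇔-sym (Lt⇔ d₂ p q)))
  transport (mono (inj₂ dec)) = mono (inj₂ λ p q p∈ q∈ →
    Lt⇔ d₁ p q ⟨⇔⟩ (dec p q (to (labels⇔ p) p∈) (to (labels⇔ q) q∈) ⟨⇔⟩ ⇔-sym (Lt⇔ d₂ q p)))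
  transport (subst x sπ sπ′ S) = subst x sπ sπ′ record
    { disjoint = disjoint
    ; x∈S      = x∈S
    ; support  = λ l → labels⇔ l ⟨⇔⟩ support l
    ; agreeπ   = λ α p q p∈ p≢x q∈ q≢x → Lt⇔ α p q ⟨⇔⟩ agreeπ α p q p∈ p≢x q∈ q≢x
    ; agreeπ'  = λ α p q p∈ q∈ → Lt⇔ α p q ⟨⇔⟩ agreeπ' α p q p∈ q∈
    ; across   = λ α p q p∈ p≢x q∈ → Lt⇔ α p q ⟨⇔⟩ across α p q p∈ p≢x q∈
    }
    where open IsSubst S

block-substitution : ∀ ρ x π′ σ {X} → (x , X) ∈ elems ρ →
  (∀ l → l ∈ labels ρ → l ∉ labels π′) →
  (∀ {l P} → (l , P) ∈ elems σ ⇔ (((l , P) ∈ elems ρ × l ≢ x) ⊎ (l , P) ∈ elems π′)) →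
  (∀ α {p P q Q} → (p , P) ∈ elems ρ → p ≢ x → (q , Q) ∈ elems π′ →
     (coord α P < coord α Q) ⇔ (coord α P < coord α X)) →
  IsSubst ρ x π′ σ
block-substitution ρ x π′ σ {X} x∈ disjoint entries beside = record
  { disjoint = disjoint
  ; x∈S      = label∈ ρ x∈
  ; support  = λ l → mk⇔ support⁻ support⁺
  ; agreeπ   = λ α p q p∈ p≢x q∈ q≢x →
      let P , pρ = pointOf ρ p∈ ; Q , qρ = pointOf ρ q∈ in
      Lt⇔coord σ α (from entries (inj₁ (pρ , p≢x))) (from entries (inj₁ (qρ , q≢x))) ⟨⇔⟩
      ⇔-sym (Lt⇔coord ρ α pρ qρ)
  ; agreeπ'  = λ α p q p∈ q∈ →
      let P , pπ′ = pointOf π′ p∈ ; Q , qπ′ = pointOf π′ q∈ in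
      Lt⇔coord σ α (from entries (inj₂ pπ′)) (from entries (inj₂ qπ′)) ⟨⇔⟩
      ⇔-sym (Lt⇔coord π′ α pπ′ qπ′)
  ; across   = λ α p q p∈ p≢x q∈ →
      let P , pρ = pointOf ρ p∈ ; Q , qπ′ = pointOf π′ q∈ in
      Lt⇔coord σ α (from entries (inj₁ (pρ , p≢x))) (from entries (inj₂ qπ′)) ⟨⇔⟩
      (beside α pρ p≢x qπ′ ⟨⇔⟩ ⇔-sym (Lt⇔coord ρ α pρ x∈))
  }
  where
  support⁻ : ∀ {l} → l ∈ labels σ → (l ∈ labels ρ × l ≢ x) ⊎ l ∈ labels π′
  support⁻ l∈ with to entries (proj₂ (pointOf σ l∈))
  ... | inj₁ (lρ , l≢x) = inj₁ (label∈ ρ lρ , l≢x)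
  ... | inj₂ lπ′        = inj₂ (label∈ π′ lπ′)
  support⁺ : ∀ {l} → (l ∈ labels ρ × l ≢ x) ⊎ l ∈ labels π′ → l ∈ labels σ
  support⁺ (inj₁ (l∈ , l≢x)) = label∈ σ (from entries (inj₁ (proj₂ (pointOf ρ l∈) , l≢x)))
  support⁺ (inj₂ l∈)         = label∈ σ (from entries (inj₂ (proj₂ (pointOf π′ l∈))))

subsingleton-monotone : ∀ σ → (∀ {a b} → a ∈ labels σ → b ∈ labels σ → a ≡ b) → Monotone σ
subsingleton-monotone σ one = inj₁ λ a b a∈ b∈ → case one a∈ b∈ of λ where
  refl → mk⇔ (⊥-elim ∘ Lt-irrefl σ d₁) (⊥-elim ∘ Lt-irrefl σ d₂)

Concordant : ℕ → ℕ → ℕ → ℕ → Set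
Concordant a b c d = (a < b × c < d) ⊎ (b < a × d < c)

concordant-or-discordant : ∀ {a b c d} → a ≢ b → c ≢ d → Concordant a b c d ⊎ Concordant a b d c
concordant-or-discordant {a} {b} {c} {d} a≢b c≢d with <-cmp a b | <-cmp c d
... | tri≈ _ a≡b _ | _            = ⊥-elim (a≢b a≡b)
... | _            | tri≈ _ c≡d _ = ⊥-elim (c≢d c≡d)
... | tri< a<b _ _ | tri< c<d _ _ = inj₁ (inj₁ (a<b , c<d))
... | tri> _ _ b<a | tri> _ _ d<c = inj₁ (inj₂ (b<a , d<c))
... | tri< a<b _ _ | tri> _ _ d<c = inj₂ (inj₁ (a<b , d<c))
... | tri> _ _ b<a | tri< c<d _ _ = inj₂ (inj₂ (b<a , c<d))

concordant-iff : ∀ {a b c d} → Concordant a b c d → (a < b ⇔ c < d) × (b < a ⇔ d < c)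
concordant-iff (inj₁ (a<b , c<d)) =
  mk⇔ (λ _ → c<d) (λ _ → a<b) , mk⇔ (λ b<a → ⊥-elim (<-asym a<b b<a)) (λ d<c → ⊥-elim (<-asym c<d d<c))
concordant-iff (inj₂ (b<a , d<c)) =
  mk⇔ (λ a<b → ⊥-elim (<-asym a<b b<a)) (λ c<d → ⊥-elim (<-asym c<d d<c)) , mk⇔ (λ _ → d<c) (λ _ → b<a)

module TwoPoints (x y : ℕ) (P Q : Point) (x≢y : x ≢ y) (0<x : 0 < x) (0<y : 0 < y)
                 (P≢Q : ∀ α → coord α P ≢ coord α Q) where

  twoPoints : Perm
  twoPoints = record
    { elems    = (x , P) ∷ (y , Q) ∷ []
    ; positive = 0<x ∷ 0<y ∷ []
    ; uniqueS  = (x≢y ∷ []) ∷ [] ∷ []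
    ; genPos₁  = (P≢Q d₁ ∷ []) ∷ [] ∷ []
    ; genPos₂  = (P≢Q d₂ ∷ []) ∷ [] ∷ []
    }

  for-entries : ∀ {Rel : Point → Point → Set} → (∀ {S} → Rel S S) → Rel P Q → Rel Q P →
                ∀ {p q P′ Q′} → (p , P′) ∈ elems twoPoints → (q , Q′) ∈ elems twoPoints → Rel P′ Q′
  for-entries diag PQ QP (here refl)         (here refl)         = diag
  for-entries diag PQ QP (here refl)         (there (here refl)) = PQ
  for-entries diag PQ QP (there (here refl)) (here refl)         = QP
  for-entries diag PQ QP (there (here refl)) (there (here refl)) = diag

  irrefl⇔ : ∀ {a c} → (a < a) ⇔ (c < c)
  irrefl⇔ = mk⇔ (⊥-elim ∘ <-irrefl refl) (⊥-elim ∘ <-irrefl refl)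

  twoPoints-monotone : Monotone twoPoints
  twoPoints-monotone with concordant-or-discordant (P≢Q d₁) (P≢Q d₂)
  ... | inj₁ conc = let PQ , QP = concordant-iff conc in inj₁ λ p q p∈ q∈ →
    let _ , p∈′ = pointOf twoPoints p∈ ; _ , q∈′ = pointOf twoPoints q∈ in
    Lt⇔coord twoPoints d₁ p∈′ q∈′ ⟨⇔⟩
    (for-entries {λ S T → (coord d₁ S < coord d₁ T) ⇔ (coord d₂ S < coord d₂ T)} irrefl⇔ PQ QP p∈′ q∈′
     ⟨⇔⟩ ⇔-sym (Lt⇔coord twoPoints d₂ p∈′ q∈′))
  ... | inj₂ disc = let PQ , QP = concordant-iff disc in inj₂ λ p q p∈ q∈ →
    let _ , p∈′ = pointOf twoPoints p∈ ; _ , q∈′ = pointOf twoPoints q∈ in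
    Lt⇔coord twoPoints d₁ p∈′ q∈′ ⟨⇔⟩
    (for-entries {λ S T → (coord d₁ S < coord d₁ T) ⇔ (coord d₂ T < coord d₂ S)} irrefl⇔ PQ QP p∈′ q∈′
     ⟨⇔⟩ ⇔-sym (Lt⇔coord twoPoints d₂ q∈′ p∈′))

-- If R and R′ are proper, apart and occupied,
-- their restrictions are separable, and every point of π in bbox R R′ lies in
-- R or R′, then π|bbox R R′ = τ[x ← π|R][y ← π|R′] where τ is the two-point
-- pattern of R and R′ (x, y are fresh labels); hence it is separable.
module MergeBlocks (π : Perm) {R R′ : Rect} (proper : ProperR R) (proper′ : ProperR R′) (apart : Apart R R′)
                   (occupied : Occupied π R) (occupied′ : Occupied π R′)
                   (content : ∀ {l P} → (l , P) ∈ elems π → InBox P (bbox R R′) → InBox P R ⊎ InBox P R′) where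

  A = restrict π R
  B = restrict π R′
  U = restrict π (bbox R R′)
  M = maxLabel π
  x = suc M
  y = suc (suc M)

  pointA = find occupied
  pointB = find occupied′
  X = proj₂ (proj₁ pointA)
  Y = proj₂ (proj₁ pointB)

  X∈R : InBox X R
  X∈R = proj₂ (proj₂ pointA)

  Y∈R′ : InBox Y R′
  Y∈R′ = proj₂ (proj₂ pointB)

  x≢y : x ≢ y
  x≢y x≡y = <-irrefl x≡y (n<1+n x)

  fresh : ∀ {l P k} → (l , P) ∈ elems π → M < k → l ≢ k
  fresh p∈ M<k refl = <⇒≱ M<k (≤-maxLabel (labels π) (label∈ π p∈))

  M<x : M < x
  M<x = n<1+n M

  M<y : M < y
  M<y = m≤n⇒m≤1+n M<x

  open TwoPoints x y X Y x≢y (s≤s z≤n) (s≤s z≤n) (apart-coord apart (X∈R) (Y∈R′))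

  -- σ₁ = τ[x ← π|R]: the point Y together with the points of R
  σ₁ : Perm
  σ₁ = record
    { elems    = (y , Y) ∷ elems A
    ; positive = s≤s z≤n ∷ positive A
    ; uniqueS  = All.tabulate (λ l∈ y≡l → let _ , p∈ , _ = label-restrict⁻ π R l∈ in fresh p∈ M<y (sym y≡l))
                 ∷ uniqueS A
    ; genPos₁  = Y-apart d₁ ∷ genPos₁ A
    ; genPos₂  = Y-apart d₂ ∷ genPos₂ A
    }
    where
    Y-apart : ∀ α → All (coord α Y ≢_) (map (coord α ∘ proj₂) (elems A))
    Y-apart α = All.tabulate λ c∈ Y≡c → case ∈-map⁻ (coord α ∘ proj₂) c∈ of λ where
      (_ , p∈ , refl) → apart-coord apart (proj₂ (∈-restrict⁻ π R p∈)) (Y∈R′) α (sym Y≡c)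

  side : ∀ α {P Q} → InBox P R → InBox Q R′ → (coord α P < coord α Q) ⇔ (coord α P < coord α Y)
  side α bP bQ = apart-side proper proper′ apart bP bQ (Y∈R′) α

  side′ : ∀ α {P Q} → InBox P R′ → InBox Q R → (coord α P < coord α Q) ⇔ (coord α P < coord α X)
  side′ α bP bQ = apart-side proper′ proper (apart-sym apart) bP bQ (X∈R) α

  first-step : IsSubst twoPoints x A σ₁
  first-step = block-substitution twoPoints x A σ₁ (here refl) disjoint (mk⇔ split join) beside
    where
    disjoint : ∀ l → l ∈ labels twoPoints → l ∉ labels A
    disjoint l (here refl) l∈A = let _ , p∈ , _ = label-restrict⁻ π R l∈A in fresh p∈ M<x refl
    disjoint l (there (here refl)) l∈A = let _ , p∈ , _ = label-restrict⁻ π R l∈A in fresh p∈ M<y refl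
    split : ∀ {l P} → (l , P) ∈ elems σ₁ → ((l , P) ∈ elems twoPoints × l ≢ x) ⊎ (l , P) ∈ elems A
    split (here refl) = inj₁ (there (here refl) , x≢y ∘ sym)
    split (there p∈)  = inj₂ p∈
    join : ∀ {l P} → ((l , P) ∈ elems twoPoints × l ≢ x) ⊎ (l , P) ∈ elems A → (l , P) ∈ elems σ₁
    join (inj₁ (here refl , x≢x))     = ⊥-elim (x≢x refl)
    join (inj₁ (there (here refl) , _)) = here refl
    join (inj₂ p∈)                    = there p∈
    beside : ∀ α {p P q Q} → (p , P) ∈ elems twoPoints → p ≢ x → (q , Q) ∈ elems A →
             (coord α P < coord α Q) ⇔ (coord α P < coord α X)
    beside α (here refl) x≢x _          = ⊥-elim (x≢x refl)
    beside α (there (here refl)) _ q∈ = side′ α (Y∈R′) (proj₂ (∈-restrict⁻ π R q∈))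

  second-step : IsSubst σ₁ y B U
  second-step = block-substitution σ₁ y B U (here refl) disjoint (mk⇔ split join) beside
    where
    disjoint : ∀ l → l ∈ labels σ₁ → l ∉ labels B
    disjoint l (here refl) l∈B = let _ , p∈ , _ = label-restrict⁻ π R′ l∈B in fresh p∈ M<y refl
    disjoint l (there l∈A) l∈B with label-restrict⁻ π R l∈A | label-restrict⁻ π R′ l∈B
    ... | P , p∈ , bP | Q , q∈ , bQ with point-unique π p∈ q∈
    ...   | refl = apart-coord apart bP bQ d₁ refl
    split : ∀ {l P} → (l , P) ∈ elems U → ((l , P) ∈ elems σ₁ × l ≢ y) ⊎ (l , P) ∈ elems B
    split p∈ with ∈-restrict⁻ π (bbox R R′) p∈
    ... | p∈π , inBox with content p∈π inBox
    ...   | inj₁ inR  = inj₁ (there (∈-restrict⁺ π R p∈π inR) , fresh p∈π M<y)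
    ...   | inj₂ inR′ = inj₂ (∈-restrict⁺ π R′ p∈π inR′)
    join : ∀ {l P} → ((l , P) ∈ elems σ₁ × l ≢ y) ⊎ (l , P) ∈ elems B → (l , P) ∈ elems U
    join (inj₁ (here refl , y≢y)) = ⊥-elim (y≢y refl)
    join (inj₁ (there p∈ , _)) = let p∈π , inR = ∈-restrict⁻ π R p∈ in
                                 ∈-restrict⁺ π (bbox R R′) p∈π (inBox-bboxˡ inR)
    join (inj₂ p∈)             = let p∈π , inR′ = ∈-restrict⁻ π R′ p∈ in
                                 ∈-restrict⁺ π (bbox R R′) p∈π (inBox-bboxʳ inR′)
    beside : ∀ α {p P q Q} → (p , P) ∈ elems σ₁ → p ≢ y → (q , Q) ∈ elems B →
             (coord α P < coord α Q) ⇔ (coord α P < coord α Y)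
    beside α (here refl) y≢y _ = ⊥-elim (y≢y refl)
    beside α (there p∈) _ q∈   = side α (proj₂ (∈-restrict⁻ π R p∈)) (proj₂ (∈-restrict⁻ π R′ q∈))

  merged-separable : Separable A → Separable B → Separable U
  merged-separable sA sB = subst y (subst x (mono twoPoints-monotone) sA first-step) sB second-step

module Blocks (π : Perm) where

  record Invariant (F : Family) (m : ℕ) : Set where
    field
      tidy    : Tidy F m
      covered : ∀ {l P} → (l , P) ∈ elems π → Σ (ℕ × Rect) λ e → e ∈ F × InBox P (proj₂ e)
      blocks  : All (λ e → Separable (restrict π (proj₂ e)) × Occupied π (proj₂ e)) F
  open Invariant

  merge-cases : ∀ {F m i j l Ri Rj R} → Tidy F m → (i , Ri) ∈ F → (j , Rj) ∈ F → (l , R) ∈ F →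
                R ≡ Ri ⊎ R ≡ Rj ⊎ (l , R) ∈ removeTwo i j F
  merge-cases {i = i} {j} {l} t i∈ j∈ l∈ with l ≟ i | l ≟ j
  ... | yes refl | _        = inj₁ (rect-unique t l∈ i∈)
  ... | no _     | yes refl = inj₂ (inj₁ (rect-unique t l∈ j∈))
  ... | no l≢i   | no l≢j   = inj₂ (inj₂ (∈-removeTwo⁺ l∈ l≢i l≢j))

  module Step {F m i j k Ri Rj} (inv : Invariant F m) (i∈ : (i , Ri) ∈ F) (j∈ : (j , Rj) ∈ F)
              (i≢j : i ≢ j) (m<k : m < k)
              (apart : PairwiseApart F) (apart′ : PairwiseApart (merge i j k Ri Rj F)) where

    survivor-apart : ∀ {e} → e ∈ removeTwo i j F → Apart (bbox Ri Rj) (proj₂ e)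
    survivor-apart e∈ = apart′ (here refl) (there e∈) (fresh-index (tidy inv) m<k (proj₁ (∈-removeTwo⁻ e∈)) ∘ sym)

    content : ∀ {l P} → (l , P) ∈ elems π → InBox P (bbox Ri Rj) → InBox P Ri ⊎ InBox P Rj
    content p∈ inBox with covered inv p∈
    ... | (_ , R) , e∈ , inR with merge-cases (tidy inv) i∈ j∈ e∈
    ...   | inj₁ refl        = inj₁ inR
    ...   | inj₂ (inj₁ refl) = inj₂ inR
    ...   | inj₂ (inj₂ e∈′)  =
            ⊥-elim (survivor-apart e∈′ d₁ (meet-intro (inBox-coord inBox d₁) (inBox-coord inR d₁)))

    covered′ : ∀ {l P} → (l , P) ∈ elems π → Σ (ℕ × Rect) λ e → e ∈ merge i j k Ri Rj F × InBox P (proj₂ e)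
    covered′ p∈ with covered inv p∈
    ... | (_ , R) , e∈ , inR with merge-cases (tidy inv) i∈ j∈ e∈
    ...   | inj₁ refl        = _ , here refl , inBox-bboxˡ inR
    ...   | inj₂ (inj₁ refl) = _ , here refl , inBox-bboxʳ inR
    ...   | inj₂ (inj₂ e∈′)  = _ , there e∈′ , inR

    merged-block : Separable (restrict π (bbox Ri Rj)) × Occupied π (bbox Ri Rj)
    merged-block = merged-separable (proj₁ (lookup (blocks inv) i∈)) (proj₁ (lookup (blocks inv) j∈)) ,
                   Any.map inBox-bboxˡ (proj₂ (lookup (blocks inv) i∈))
      where
      proper-rect = lookup (proper (tidy inv))
      open MergeBlocks π (proper-rect i∈) (proper-rect j∈) (apart i∈ j∈ i≢j)
                       (proj₂ (lookup (blocks inv) i∈)) (proj₂ (lookup (blocks inv) j∈)) content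

    merge-invariant : Invariant (merge i j k Ri Rj F) k
    merge-invariant = record
      { tidy    = tidy-merge (tidy inv) i∈ j∈ m<k
      ; covered = covered′
      ; blocks  = all-merge (blocks inv) merged-block
      }

  -- a single covering rectangle restricts π to itself
  final : ∀ {F m} → length F ≡ 1 → Invariant F m → Separable π
  final {_ ∷ []} _ inv =
    separable-same-points (mk⇔ (proj₁ ∘ ∈-restrict⁻ π R) inR) (proj₁ (lookup (blocks inv) (here refl)))
    where
    R = _
    inR : ∀ {l P} → (l , P) ∈ elems π → (l , P) ∈ elems (restrict π R)
    inR p∈ with covered inv p∈
    ... | _ , here refl , inBox = ∈-restrict⁺ π R p∈ inBox

  decomposition-separable : ∀ {d F m} → d ≤ 1 → Decomp d F m → Invariant F m → Separable π
  decomposition-separable d≤1 (done _ len) inv = final len inv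
  decomposition-separable d≤1 (step i j k Ri Rj i∈ j∈ i≢j m<k wide rest) inv =
    decomposition-separable d≤1 rest
      (Step.merge-invariant inv i∈ j∈ i≢j m<k (wide⇒apart _ d≤1 wide) (wide⇒apart _ d≤1 (first-wide rest)))
    where
    first-wide : ∀ {d F m} → Decomp d F m → Wide d F
    first-wide (done w _)                  = w
    first-wide (step _ _ _ _ _ _ _ _ _ w _) = w

  initial : Invariant (toFamily π) (maxLabel π)
  initial = record
    { tidy    = tidy-init π
    ; covered = λ {l} {P} p∈ → (l , pointRect P) , ∈-toFamily⁺ π p∈ , inBox-pointRect P
    ; blocks  = All.tabulate λ e∈ → case ∈-toFamily⁻ π e∈ of λ where
        (p , p∈ , refl) → mono (subsingleton-monotone (restrict π (pointRect (proj₂ p))) (only p∈)) , pointRect-occupied π p∈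
    }
    where
    only : ∀ {p} → p ∈ elems π → ∀ {a b} → a ∈ labels (restrict π (pointRect (proj₂ p))) →
           b ∈ labels (restrict π (pointRect (proj₂ p))) → a ≡ b
    only p∈ a∈ b∈ = trans (is-p p∈ a∈) (sym (is-p p∈ b∈))
      where
      is-p : ∀ {p} → p ∈ elems π → ∀ {l} → l ∈ labels (restrict π (pointRect (proj₂ p))) → l ≡ proj₁ p
      is-p p∈ l∈ with label-restrict⁻ π _ l∈
      ... | P , q∈ , ((≤P , P≤) , _) = coord-injective π d₁ q∈ p∈ (≤-antisym P≤ ≤P)

narrow⇒separable : ∀ π → WidthAtMost π 1 → Separable π
narrow⇒separable π (d , d≤1 , dec) = Blocks.decomposition-separable π d≤1 dec (Blocks.initial π)

proposition3 : (π : Perm) → elems π ≢ [] → Separable π ⇔ WidthAtMost π 1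
proposition3 π π≢[] = mk⇔ (adjacent⇒narrow π π≢[] ∘ separable-adjacent) (narrow⇒separable π)
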